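{- Let $\{F_1,\dots,F_k\}$ ($k\ge1$) be a set of mutually orthogonal binary $n\times n$ squares of type $(n;\lambda_0,\lambda_1)$, and let $\mathcal{B}=\{B_{i,j}:1\le i,j\le n\}$ with $B_{i,j}=\{x:\text{cell }(i,j)\text{ of }F_x\text{ is }1\}$ be the collection of blocks derived from it. If all blocks $B_{i,j}$ have the same size, then $\lambda_1\in\{0,n\}$; consequently the derived design is a $(0,0)$-design or an $(n^2,n^2)$-design, i.e. it is trivial.
   Context: Here a binary square of type $(n;\lambda_0,\lambda_1)$, $\lambda_0+\lambda_1=n$, is an $n\times n$ $(0,1)$-matrix with exactly $\lambda_0$ zeros and $\lambda_1$ ones in each row and column; two such squares are orthogonal if exactly $\lambda_1^2$ cells contain $1$ in both. An $(R,\Lambda)$-design is a design in which every point occurs in exactly $R$ blocks and every pair of distinct points occurs in exactly $\Lambda$ blocks. -}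

module Defs where

open import Data.Nat using (ℕ; _*_)
open import Data.Bool using (Bool; true; false; _∧_)
open import Data.Fin using (Fin)
open import Data.Vec using (Vec; tabulate; lookup; sum)
open import Data.Fin.Subset using (Subset; ∁; ∣_∣)
open import Data.Product using (_×_; _,_)
open import Relation.Binary.PropositionalEquality using (_≡_; _≢_)

Square : ℕ → Set
Square n = Fin n → Fin n → Bool

row : ∀ {n} → Square n → Fin n → Subset n
row F i = tabulate (λ j → F i j)

col : ∀ {n} → Square n → Fin n → Subset n
col F j = tabulate (λ i → F i j)

cellCount : ∀ {n} → (Fin n → Fin n → Bool) → ℕ
cellCount {n} P = sum (tabulate (λ i → ∣ tabulate (λ j → P i j) ∣))

IsBinarySquare : (n λ0 λ1 : ℕ) → Square n → Set
IsBinarySquare n λ0 λ1 F =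
  (∀ i → ∣ row F i ∣ ≡ λ1 × ∣ ∁ (row F i) ∣ ≡ λ0) ×
  (∀ j → ∣ col F j ∣ ≡ λ1 × ∣ ∁ (col F j) ∣ ≡ λ0)

Orthogonal : ∀ {n} → ℕ → Square n → Square n → Set
Orthogonal λ1 F G = cellCount (λ i j → F i j ∧ G i j) ≡ λ1 * λ1

IsMOBS : (n λ0 λ1 k : ℕ) → (Fin k → Square n) → Set
IsMOBS n λ0 λ1 k F =
  (∀ x → IsBinarySquare n λ0 λ1 (F x)) ×
  (∀ x y → x ≢ y → Orthogonal λ1 (F x) (F y))

block : ∀ {n k} → (Fin k → Square n) → Fin n → Fin n → Subset k
block F i j = tabulate (λ x → F x i j)

-- (R, Λ)-design on point set Fin k with blocks indexed by cells (i , j) (a multiset of blocks)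
IsDesign : ∀ {n k} → ℕ → ℕ → (Fin n → Fin n → Subset k) → Set
IsDesign {n} {k} R Λ B =
  (∀ (x : Fin k) → cellCount (λ i j → lookup (B i j) x) ≡ R) ×
  (∀ (x y : Fin k) → x ≢ y → cellCount (λ i j → lookup (B i j) x ∧ lookup (B i j) y) ≡ Λ)

{-# OPTIONS --safe #-}

-- Let s be the common block size and fix a point x. Counting incidences between cells and
-- squares gives n²s = k·nλ₁; counting the pairs (y, cell) whose block contains both x and y
-- gives s·nλ₁ = nλ₁ + (k − 1)λ₁², by orthogonality. Eliminating s leaves nλ₁² = n²λ₁, so
-- λ₁ ∈ {0, n}. Then every square is constant, and so is every block.

module Submission where

open import Defs
open import Data.Bool using (Bool; true; false; _∧_; not)
open import Data.Bool.Properties using (∧-idem; not-involutive)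
open import Data.Fin using (Fin; zero; suc; punchIn)
open import Data.Fin.Properties using (punchInᵢ≢i)
open import Data.Fin.Subset using (∣_∣; ⊤)
open import Data.Fin.Subset.Properties using (∣p∣≡n⇒p≡⊤)
open import Data.Nat using (ℕ; zero; suc; _+_; _*_; _≤_)
open import Data.Nat.Properties
  using (+-*-semiring; +-cancelˡ-≡; *-cancelˡ-≡; *-cancelʳ-≡; *-identityʳ; +-identityʳ; m≤n+m; n≤0⇒n≡0)
open import Algebra.Properties.Semiring.Sum +-*-semiring
  using (sum; sum-syntax; sum-cong-≗; sum-replicate-zero; sum-remove; ∑-comm;
         *-distribˡ-sum; *-distribʳ-sum)
open import Data.Nat.Solver using (module +-*-Solver)
open import Data.Product using (_×_; _,_; ∃-syntax; proj₁; proj₂)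
open import Data.Sum using (_⊎_; inj₁; inj₂)
open import Data.Vec as Vec using (tabulate; lookup)
open import Data.Vec.Properties using (lookup∘tabulate; lookup-replicate; tabulate-∘)
open import Function using (_∘_)
open import Relation.Binary.PropositionalEquality
open ≡-Reasoning
open +-*-Solver using (solve; _:+_; _:*_; _:=_; con)

𝟙 : Bool → ℕ
𝟙 true  = 1
𝟙 false = 0

𝟙-∧ : ∀ a b → 𝟙 (a ∧ b) ≡ 𝟙 a * 𝟙 b
𝟙-∧ true  b = sym (+-identityʳ (𝟙 b))
𝟙-∧ false b = refl

∑-const : ∀ n c → ∑[ i < n ] c ≡ n * c
∑-const zero    c = refl
∑-const (suc n) c = cong (c +_) (∑-const n c)

∑-pointed : ∀ {k c} (g : Fin (suc k) → ℕ) x → (∀ y → y ≢ x → g y ≡ c) →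
            sum g ≡ g x + k * c
∑-pointed {k} {c} g x others = begin
  sum g                             ≡⟨ sum-remove g ⟩
  g x + ∑[ j < k ] g (punchIn x j)  ≡⟨ cong (g x +_) (sum-cong-≗ (λ j → others _ (punchInᵢ≢i x j))) ⟩
  g x + ∑[ j < k ] c                ≡⟨ cong (g x +_) (∑-const k c) ⟩
  g x + k * c                       ∎

∑₃-comm : ∀ {m n k} (g : Fin m → Fin n → Fin k → ℕ) →
          ∑[ i < m ] ∑[ j < n ] ∑[ x < k ] g i j x ≡ ∑[ x < k ] ∑[ i < m ] ∑[ j < n ] g i j x
∑₃-comm g = trans (sum-cong-≗ (λ i → ∑-comm (g i))) (∑-comm (λ i x → ∑[ j < _ ] g i j x))

∑₂-distribʳ : ∀ {m n} (f : Fin m → Fin n → ℕ) c →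
              (∑[ i < m ] ∑[ j < n ] f i j) * c ≡ ∑[ i < m ] ∑[ j < n ] (f i j * c)
∑₂-distribʳ {n = n} f c =
  trans (*-distribʳ-sum c (λ i → ∑[ j < n ] f i j)) (sum-cong-≗ (λ i → *-distribʳ-sum c (f i)))

sum-tabulate : ∀ {n} (f : Fin n → ℕ) → Vec.sum (tabulate f) ≡ sum f
sum-tabulate {zero}  f = refl
sum-tabulate {suc n} f = cong (f zero +_) (sum-tabulate (f ∘ suc))

∣tabulate∣≡∑𝟙 : ∀ {n} (P : Fin n → Bool) → ∣ tabulate P ∣ ≡ ∑[ j < n ] 𝟙 (P j)
∣tabulate∣≡∑𝟙 {zero}  P = refl
∣tabulate∣≡∑𝟙 {suc n} P with P zero
... | true  = cong suc (∣tabulate∣≡∑𝟙 (P ∘ suc))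
... | false = ∣tabulate∣≡∑𝟙 (P ∘ suc)

∣tabulate∣≡n⇒≡true : ∀ {n} (P : Fin n → Bool) → ∣ tabulate P ∣ ≡ n → ∀ j → P j ≡ true
∣tabulate∣≡n⇒≡true P full j = begin
  P j                   ≡⟨ lookup∘tabulate P j ⟨
  lookup (tabulate P) j ≡⟨ cong (λ p → lookup p j) (∣p∣≡n⇒p≡⊤ {p = tabulate P} full) ⟩
  lookup ⊤ j            ≡⟨ lookup-replicate j true ⟩
  true                  ∎

cellCount≡∑∑𝟙 : ∀ {n} (P : Fin n → Fin n → Bool) →
                cellCount P ≡ ∑[ i < n ] ∑[ j < n ] 𝟙 (P i j)
cellCount≡∑∑𝟙 {n} P =
  trans (sum-tabulate (λ i → ∣ tabulate (P i) ∣)) (sum-cong-≗ (λ i → ∣tabulate∣≡∑𝟙 (P i)))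

cellCount-cong : ∀ {n} {P Q : Fin n → Fin n → Bool} → (∀ i j → P i j ≡ Q i j) →
                 cellCount P ≡ cellCount Q
cellCount-cong {n} {P} {Q} P≡Q = begin
  cellCount P                       ≡⟨ cellCount≡∑∑𝟙 P ⟩
  ∑[ i < n ] ∑[ j < n ] 𝟙 (P i j)   ≡⟨ sum-cong-≗ (λ i → sum-cong-≗ (λ j → cong 𝟙 (P≡Q i j))) ⟩
  ∑[ i < n ] ∑[ j < n ] 𝟙 (Q i j)   ≡⟨ cellCount≡∑∑𝟙 Q ⟨
  cellCount Q                       ∎

cellCount-false : ∀ {n} → cellCount {n} (λ _ _ → false) ≡ 0
cellCount-false {n} = begin
  cellCount {n} (λ _ _ → false)  ≡⟨ cellCount≡∑∑𝟙 {n} (λ _ _ → false) ⟩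
  ∑[ i < n ] ∑[ j < n ] 0        ≡⟨ cong (λ c → ∑[ i < n ] c) (sum-replicate-zero n) ⟩
  ∑[ i < n ] 0                   ≡⟨ sum-replicate-zero n ⟩
  0                              ∎

cellCount-true : ∀ {n} → cellCount {n} (λ _ _ → true) ≡ n * n
cellCount-true {n} = begin
  cellCount {n} (λ _ _ → true)  ≡⟨ cellCount≡∑∑𝟙 {n} (λ _ _ → true) ⟩
  ∑[ i < n ] ∑[ j < n ] 1       ≡⟨ cong (λ c → ∑[ i < n ] c) (trans (∑-const n 1) (*-identityʳ n)) ⟩
  ∑[ i < n ] n                  ≡⟨ ∑-const n n ⟩
  n * n                         ∎

module _ {n λ0 λ1 : ℕ} {F : Square n} (square : IsBinarySquare n λ0 λ1 F) where

  cellCount≡n*λ1 : cellCount F ≡ n * λ1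
  cellCount≡n*λ1 = begin
    cellCount F               ≡⟨ sum-tabulate (λ i → ∣ row F i ∣) ⟩
    ∑[ i < n ] ∣ row F i ∣    ≡⟨ sum-cong-≗ (λ i → proj₁ (proj₁ square i)) ⟩
    ∑[ i < n ] λ1             ≡⟨ ∑-const n λ1 ⟩
    n * λ1                    ∎

  λ1≡n⇒cells≡true : λ1 ≡ n → ∀ i j → F i j ≡ true
  λ1≡n⇒cells≡true λ1≡n i = ∣tabulate∣≡n⇒≡true (F i) (trans (proj₁ (proj₁ square i)) λ1≡n)

  λ1≡0⇒cells≡false : λ0 + λ1 ≡ n → λ1 ≡ 0 → ∀ i j → F i j ≡ false
  λ1≡0⇒cells≡false λ0+λ1≡n λ1≡0 i j =
    trans (sym (not-involutive (F i j))) (cong not (∣tabulate∣≡n⇒≡true (not ∘ F i) zeros≡n j))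
    where
    λ0≡n : λ0 ≡ n
    λ0≡n = trans (sym (+-identityʳ λ0)) (trans (cong (λ0 +_) (sym λ1≡0)) λ0+λ1≡n)
    zeros≡n : ∣ tabulate (not ∘ F i) ∣ ≡ n
    zeros≡n = trans (cong ∣_∣ (tabulate-∘ not (F i))) (trans (proj₂ (proj₁ square i)) λ0≡n)

module _ {n k : ℕ} (F : Fin k → Square n) where

  ∑-blockSize : ∑[ i < n ] ∑[ j < n ] ∣ block F i j ∣ ≡ ∑[ x < k ] cellCount (F x)
  ∑-blockSize = begin
    ∑[ i < n ] ∑[ j < n ] ∣ block F i j ∣
      ≡⟨ sum-cong-≗ (λ i → sum-cong-≗ (λ j → ∣tabulate∣≡∑𝟙 (λ y → F y i j))) ⟩
    ∑[ i < n ] ∑[ j < n ] ∑[ x < k ] 𝟙 (F x i j)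
      ≡⟨ ∑₃-comm (λ i j x → 𝟙 (F x i j)) ⟩
    ∑[ x < k ] ∑[ i < n ] ∑[ j < n ] 𝟙 (F x i j)
      ≡⟨ sum-cong-≗ (λ x → cellCount≡∑∑𝟙 (F x)) ⟨
    ∑[ x < k ] cellCount (F x)
      ∎

  ∑-incidence*blockSize : ∀ x →
    ∑[ i < n ] ∑[ j < n ] (𝟙 (F x i j) * ∣ block F i j ∣) ≡
    ∑[ y < k ] cellCount (λ i j → F x i j ∧ F y i j)
  ∑-incidence*blockSize x = begin
    ∑[ i < n ] ∑[ j < n ] (𝟙 (F x i j) * ∣ block F i j ∣)
      ≡⟨ sum-cong-≗ (λ i → sum-cong-≗ (λ j → incidence*blockSize i j)) ⟩
    ∑[ i < n ] ∑[ j < n ] ∑[ y < k ] 𝟙 (F x i j ∧ F y i j)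
      ≡⟨ ∑₃-comm (λ i j y → 𝟙 (F x i j ∧ F y i j)) ⟩
    ∑[ y < k ] ∑[ i < n ] ∑[ j < n ] 𝟙 (F x i j ∧ F y i j)
      ≡⟨ sum-cong-≗ (λ y → cellCount≡∑∑𝟙 (λ i j → F x i j ∧ F y i j)) ⟨
    ∑[ y < k ] cellCount (λ i j → F x i j ∧ F y i j)
      ∎
    where
    incidence*blockSize : ∀ i j →
      𝟙 (F x i j) * ∣ block F i j ∣ ≡ ∑[ y < k ] 𝟙 (F x i j ∧ F y i j)
    incidence*blockSize i j = begin
      𝟙 (F x i j) * ∣ block F i j ∣
        ≡⟨ cong (𝟙 (F x i j) *_) (∣tabulate∣≡∑𝟙 (λ y → F y i j)) ⟩
      𝟙 (F x i j) * ∑[ y < k ] 𝟙 (F y i j)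
        ≡⟨ *-distribˡ-sum (𝟙 (F x i j)) (λ y → 𝟙 (F y i j)) ⟩
      ∑[ y < k ] (𝟙 (F x i j) * 𝟙 (F y i j))
        ≡⟨ sum-cong-≗ (λ y → 𝟙-∧ (F x i j) (F y i j)) ⟨
      ∑[ y < k ] 𝟙 (F x i j ∧ F y i j)
        ∎

uniform⇒constant : ∀ {n} (f : Fin n → Fin n → ℕ) → (∀ i j i′ j′ → f i j ≡ f i′ j′) →
                   ∃[ s ] ∀ i j → f i j ≡ s
uniform⇒constant {zero}  f uniform = 0 , λ ()
uniform⇒constant {suc n} f uniform = f zero zero , λ i j → uniform i j zero zero

module _ {n λ0 λ1 k : ℕ} {F : Fin (suc k) → Square n} (mobs : IsMOBS n λ0 λ1 (suc k) F)
         {s : ℕ} (blockSize≡s : ∀ i j → ∣ block F i j ∣ ≡ s) where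

  private
    ones : ∀ x → cellCount (F x) ≡ n * λ1
    ones x = cellCount≡n*λ1 (proj₁ mobs x)

  blockCount-equation : n * (n * s) ≡ suc k * (n * λ1)
  blockCount-equation = begin
    n * (n * s)                            ≡⟨ ∑-const n (n * s) ⟨
    ∑[ i < n ] (n * s)                      ≡⟨ cong (λ c → ∑[ i < n ] c) (∑-const n s) ⟨
    ∑[ i < n ] ∑[ j < n ] s                 ≡⟨ sum-cong-≗ (λ i → sum-cong-≗ (blockSize≡s i)) ⟨
    ∑[ i < n ] ∑[ j < n ] ∣ block F i j ∣   ≡⟨ ∑-blockSize F ⟩
    ∑[ x < suc k ] cellCount (F x)          ≡⟨ sum-cong-≗ ones ⟩
    ∑[ x < suc k ] (n * λ1)                 ≡⟨ ∑-const (suc k) (n * λ1) ⟩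
    suc k * (n * λ1)                        ∎

  pairCount-equation : n * λ1 * s ≡ n * λ1 + k * (λ1 * λ1)
  pairCount-equation = begin
    n * λ1 * s
      ≡⟨ cong (_* s) (ones zero) ⟨
    cellCount (F zero) * s
      ≡⟨ cong (_* s) (cellCount≡∑∑𝟙 (F zero)) ⟩
    (∑[ i < n ] ∑[ j < n ] 𝟙 (F zero i j)) * s
      ≡⟨ ∑₂-distribʳ (λ i j → 𝟙 (F zero i j)) s ⟩
    ∑[ i < n ] ∑[ j < n ] (𝟙 (F zero i j) * s)
      ≡⟨ sum-cong-≗ (λ i → sum-cong-≗ (λ j → cong (𝟙 (F zero i j) *_) (blockSize≡s i j))) ⟨
    ∑[ i < n ] ∑[ j < n ] (𝟙 (F zero i j) * ∣ block F i j ∣)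
      ≡⟨ ∑-incidence*blockSize F zero ⟩
    ∑[ y < suc k ] cellCount (λ i j → F zero i j ∧ F y i j)
      ≡⟨ ∑-pointed _ zero (λ y y≢0 → proj₂ mobs zero y (y≢0 ∘ sym)) ⟩
    cellCount (λ i j → F zero i j ∧ F zero i j) + k * (λ1 * λ1)
      ≡⟨ cong (_+ k * (λ1 * λ1)) (cellCount-cong (λ i j → ∧-idem (F zero i j))) ⟩
    cellCount (F zero) + k * (λ1 * λ1)
      ≡⟨ cong (_+ k * (λ1 * λ1)) (ones zero) ⟩
    n * λ1 + k * (λ1 * λ1)
      ∎

eliminate-blockSize : ∀ n l k s → n * (n * s) ≡ suc k * (n * l) →
                      n * l * s ≡ n * l + k * (l * l) → n * (l * l) ≡ n * (n * l)
eliminate-blockSize n l k s blockCount pairCount = +-cancelˡ-≡ (n * (k * (l * l))) _ _ (begin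
  n * (k * (l * l)) + n * (l * l)
    ≡⟨ solve 3 (λ n l k → n :* (k :* (l :* l)) :+ n :* (l :* l) := (con 1 :+ k) :* (n :* l) :* l)
               refl n l k ⟩
  suc k * (n * l) * l
    ≡⟨ cong (_* l) blockCount ⟨
  n * (n * s) * l
    ≡⟨ solve 3 (λ n l s → n :* (n :* s) :* l := n :* (n :* l :* s)) refl n l s ⟩
  n * (n * l * s)
    ≡⟨ cong (n *_) pairCount ⟩
  n * (n * l + k * (l * l))
    ≡⟨ solve 3 (λ n l k → n :* (n :* l :+ k :* (l :* l)) := n :* (k :* (l :* l)) :+ n :* (n :* l))
               refl n l k ⟩
  n * (k * (l * l)) + n * (n * l)
    ∎)

nl²≡n²l⇒l≡0⊎l≡n : ∀ {n l} → l ≤ n → n * (l * l) ≡ n * (n * l) → l ≡ 0 ⊎ l ≡ n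
nl²≡n²l⇒l≡0⊎l≡n {zero}  l≤0 _ = inj₁ (n≤0⇒n≡0 l≤0)
nl²≡n²l⇒l≡0⊎l≡n {suc n} {zero}  _ _ = inj₁ refl
nl²≡n²l⇒l≡0⊎l≡n {suc n} {suc l} _ eq =
  inj₂ (*-cancelʳ-≡ (suc l) (suc n) (suc l) (*-cancelˡ-≡ _ _ (suc n) eq))

constant⇒IsDesign : ∀ {n k b R} (F : Fin k → Square n) → (∀ x i j → F x i j ≡ b) →
                    cellCount {n} (λ _ _ → b) ≡ R → IsDesign R R (block F)
constant⇒IsDesign {b = b} F F≡b count≡R =
    (λ x → trans (cellCount-cong (entry x)) count≡R)
  , (λ x y _ → trans (cellCount-cong (λ i j → trans (cong₂ _∧_ (entry x i j) (entry y i j)) (∧-idem b)))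
                     count≡R)
  where
  entry : ∀ x i j → lookup (block F i j) x ≡ b
  entry x i j = trans (lookup∘tabulate (λ y → F y i j) x) (F≡b x i j)

lemma3p4 : (n λ0 λ1 k : ℕ) → λ0 + λ1 ≡ n → 1 ≤ k →
    (F : Fin k → Square n) → IsMOBS n λ0 λ1 k F →
    (∀ i j i′ j′ → ∣ block F i j ∣ ≡ ∣ block F i′ j′ ∣) →
    ((λ1 ≡ 0 ⊎ λ1 ≡ n) ×
     (IsDesign 0 0 (block F) ⊎ IsDesign (n * n) (n * n) (block F)))
lemma3p4 n λ0 λ1 (suc k) λ0+λ1≡n _ F mobs@(square , _) sameSize = λ1≡0⊎λ1≡n , trivial λ1≡0⊎λ1≡n
  where
  blockSize : ∃[ s ] ∀ i j → ∣ block F i j ∣ ≡ s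
  blockSize = uniform⇒constant (λ i j → ∣ block F i j ∣) sameSize

  s : ℕ
  s = proj₁ blockSize

  λ1≡0⊎λ1≡n : λ1 ≡ 0 ⊎ λ1 ≡ n
  λ1≡0⊎λ1≡n = nl²≡n²l⇒l≡0⊎l≡n (subst (λ1 ≤_) λ0+λ1≡n (m≤n+m λ1 λ0))
    (eliminate-blockSize n λ1 k s (blockCount-equation mobs (proj₂ blockSize))
                                  (pairCount-equation mobs (proj₂ blockSize)))

  trivial : λ1 ≡ 0 ⊎ λ1 ≡ n → IsDesign 0 0 (block F) ⊎ IsDesign (n * n) (n * n) (block F)
  trivial (inj₁ λ1≡0) =
    inj₁ (constant⇒IsDesign F (λ x → λ1≡0⇒cells≡false (square x) λ0+λ1≡n λ1≡0) (cellCount-false {n}))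
  trivial (inj₂ λ1≡n) =
    inj₂ (constant⇒IsDesign F (λ x → λ1≡n⇒cells≡true (square x) λ1≡n) (cellCount-true {n}))
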